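{- In the hybrid logic $\mathcal{H}_{\Sigma}(@_z)$, let $s\in S$ and let $\Gamma_s$ be a maximal consistent set of formulas of sort $s$ that contains a state symbol of sort $s$. For each state symbol $z$, of sort $t$ say, let $\Delta_z=\{\phi \text{ of sort } t\mid @^s_z\phi\in\Gamma_s\}$. Then: 1) for every state symbol $z$ of sort $s$, $\Delta_z$ is a maximal consistent set that contains $z$; 2) for all state symbols $z,y$ of the same sort $t$ and every formula $\phi$ of sort $t$, $@^t_z\phi\in\Delta_y$ if and only if $@^s_z\phi\in\Gamma_s$; 3) there is a state symbol $z$ such that $\Gamma_s=\Delta_z$; 4) for all state symbols $z,y$ of the same sort, if $z\in\Delta_y$ then $\Delta_z=\Delta_y$.
   Context: A many-sorted signature $(S,\Sigma)$ consists of a set $S$ of sorts and operation symbols $\sigma:s_1\cdots s_n\to s$; $\Sigma_{s_1\cdots s_n,s}$ is the set of symbols of that type. Fix countable $S$-sorted sets $\mathrm{PROP}$ (propositional variables), $\mathrm{NOM}$ (nominals), $\mathrm{SVAR}$ (state variables), pairwise disjoint. A state symbol of sort $s$ is an element of $\mathrm{NOM}_s\cup\mathrm{SVAR}_s$. Formulas of sort $s$: $\phi_s ::= p\mid j\mid x\mid \neg\phi_s\mid \phi_s\vee\phi_s\mid \sigma(\phi_{s_1},\ldots,\phi_{s_n})\mid @^s_z\psi$, with $p\in\mathrm{PROP}_s$, $j\in\mathrm{NOM}_s$, $x\in\mathrm{SVAR}_s$, $\sigma\in\Sigma_{s_1\cdots s_n,s}$, and $z$ a state symbol of some sort $t$,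 $\psi$ of sort $t$ (for every $s$, $@^s_z\psi$ has sort $s$). Usual derived connectives; $\sigma^{\Box}(\phi_1,\ldots,\phi_n):=\neg\sigma(\neg\phi_1,\ldots,\neg\phi_n)$. Theorems $\vdash_s\phi$: the least family containing the axioms and closed under the rules. Axioms: instances at each sort of propositional tautologies; $(K_\sigma)$ $\sigma^\Box(\ldots,\phi\to\chi,\ldots)\to(\sigma^\Box(\ldots,\phi,\ldots)\to\sigma^\Box(\ldots,\chi,\ldots))$; $(Dual_\sigma)$ $\sigma(\psi_1,\ldots,\psi_n)\leftrightarrow\neg\sigma^\Box(\neg\psi_1,\ldots,\neg\psi_n)$; $(K@)$ $@^s_z(\phi\to\psi)\to(@^s_z\phi\to @^s_z\psi)$; $(SelfDual)$ $@^s_z\phi\leftrightarrow\neg @^s_z\neg\phi$; $(Intro)$ $z\to(\phi\leftrightarrow @^s_z\phi)$ ($z,\phi$ of sort $s$); $(Agree)$ $@^t_y @^{t'}_z\phi\leftrightarrow @^t_z\phi$ ($y$ of sort $t'$; $z,\phi$ of a common sort); $(Ref)$ $@^s_z z$; $(Back)$ $\sigma(\phi_1,\ldots,@^{s_i}_z\psi,\ldots,\phi_n)\to @^s_z\psi$ for $\sigma\in\Sigma_{s_1\cdots s_n,s}$. Rules: Modus Ponens; (UG) from $\vdash_{s_i}\phi$ infer $\vdash_s\sigma^\Box(\phi_1,\ldots,\phi,\ldots,\phi_n)$; (BroadcastS) from $\vdash_s @^s_z\phi$ infer $\vdash_{s'}@^{s'}_z\phi$; (Gen@) from $\vdash_{s'}\phi$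 infer $\vdash_s @^s_z\phi$ ($z,\phi$ of sort $s'$); (Paste0) from $\vdash_s @^s_z(y\wedge\phi)\to\psi$ infer $\vdash_s @^s_z\phi\to\psi$; (Paste1) from $\vdash_s @^s_z\sigma(\ldots,y\wedge\phi,\ldots)\to\psi$ infer $\vdash_s @^s_z\sigma(\ldots,\phi,\ldots)\to\psi$; in the Paste rules $y$ is a state symbol distinct from $z$ not occurring in $\phi$ or $\psi$. A set $\Gamma$ of formulas of sort $t$ is consistent if there are no $\phi_1,\ldots,\phi_n\in\Gamma$ with $\vdash_t\neg(\phi_1\wedge\cdots\wedge\phi_n)$; it is maximal consistent if it is consistent and for every formula $\phi$ of sort $t$, $\phi\in\Gamma$ or $\neg\phi\in\Gamma$. -}

module Defs where

open import Level using (0ℓ)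
open import Data.Nat using (ℕ)
open import Data.Bool using (Bool; true; false; not; _∨_)
open import Data.List using (List; []; _∷_)
open import Data.Product using (Σ; _×_; _,_)
open import Data.Sum using (_⊎_)
open import Relation.Binary.PropositionalEquality using (_≡_)
open import Relation.Nullary using (¬_)
open import Relation.Unary using (Pred; _∈_)
open import Function.Definitions using (Injective)

CountableSorted : {S : Set} → (S → Set) → Set
CountableSorted {S} X = (s : S) → Σ (X s → ℕ) (λ f → Injective _≡_ _≡_ f)

-- Pairwise disjointness is built in: they are separate
-- types, and state symbols are the tagged sum NOM ⊎ SVAR.
record Language : Set₁ where
  field
    Sort : Set
    Op   : List Sort → Sort → Set      -- Op (s₁ ∷ … ∷ sₙ ∷ []) s = Σ_{s₁⋯sₙ,s}
    PROP : Sort → Set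
    NOM  : Sort → Set
    SVAR : Sort → Set
    PROP-countable : CountableSorted PROP
    NOM-countable  : CountableSorted NOM
    SVAR-countable : CountableSorted SVAR

module Logic (L : Language) where
  open Language L

  StSym : Sort → Set
  StSym s = NOM s ⊎ SVAR s

  mutual
    data Form (s : Sort) : Set where
      prop : PROP s → Form s
      sym  : StSym s → Form s
      ¬'_  : Form s → Form s
      _∨'_ : Form s → Form s → Form s
      app  : ∀ {ss} → Op ss s → Args ss → Form s
      at   : ∀ {t} → StSym t → Form t → Form s  -- @^s_z ψ

    data Args : List Sort → Set where
      []  : Args []
      _∷_ : ∀ {s ss} → Form s → Args ss → Args (s ∷ ss)

  infix 8 ¬'_
  infixr 6 _∨'_ _∧'_
  infixr 5 _⇒'_
  infix 4 _⇔'_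

  _∧'_ : ∀ {s} → Form s → Form s → Form s
  φ ∧' ψ = ¬' (¬' φ ∨' ¬' ψ)

  _⇒'_ : ∀ {s} → Form s → Form s → Form s
  φ ⇒' ψ = ¬' φ ∨' ψ

  _⇔'_ : ∀ {s} → Form s → Form s → Form s
  φ ⇔' ψ = (φ ⇒' ψ) ∧' (ψ ⇒' φ)

  negArgs : ∀ {ss} → Args ss → Args ss
  negArgs [] = []
  negArgs (φ ∷ as) = ¬' φ ∷ negArgs as

  box : ∀ {ss s} → Op ss s → Args ss → Form s
  box σ as = ¬' app σ (negArgs as)

  data Ctx : List Sort → Sort → Set where
    here  : ∀ {t ss} → Args ss → Ctx (t ∷ ss) t
    there : ∀ {s ss t} → Form s → Ctx ss t → Ctx (s ∷ ss) t

  plug : ∀ {ss t} → Ctx ss t → Form t → Args ss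
  plug (here as) φ = φ ∷ as
  plug (there ψ c) φ = ψ ∷ plug c φ

  data PF : Set where
    pv  : ℕ → PF
    pneg : PF → PF
    por : PF → PF → PF

  evalPF : (ℕ → Bool) → PF → Bool
  evalPF v (pv n) = v n
  evalPF v (pneg P) = not (evalPF v P)
  evalPF v (por P Q) = evalPF v P ∨ evalPF v Q

  Tautology : PF → Set
  Tautology P = (v : ℕ → Bool) → evalPF v P ≡ true

  instPF : ∀ {s} → (ℕ → Form s) → PF → Form s
  instPF f (pv n) = f n
  instPF f (pneg P) = ¬' instPF f P
  instPF f (por P Q) = instPF f P ∨' instPF f Q

  mutual
    data Occurs {u : Sort} (y : StSym u) : ∀ {s} → Form s → Set where
      o-sym  : Occurs y (sym y)
      o-¬    : ∀ {s} {φ : Form s} → Occurs y φ → Occurs y (¬' φ)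
      o-∨ˡ   : ∀ {s} {φ ψ : Form s} → Occurs y φ → Occurs y (φ ∨' ψ)
      o-∨ʳ   : ∀ {s} {φ ψ : Form s} → Occurs y ψ → Occurs y (φ ∨' ψ)
      o-app  : ∀ {s ss} {σ : Op ss s} {as : Args ss} → OccursArgs y as → Occurs y (app σ as)
      o-atˢ  : ∀ {s} {φ : Form u} → Occurs y (at {s} y φ)
      o-at   : ∀ {s t} {z : StSym t} {φ : Form t} → Occurs y φ → Occurs y (at {s} z φ)

    data OccursArgs {u : Sort} (y : StSym u) : ∀ {ss} → Args ss → Set where
      oa-hd : ∀ {s ss} {φ : Form s} {as : Args ss} → Occurs y φ → OccursArgs y (φ ∷ as)
      oa-tl : ∀ {s ss} {φ : Form s} {as : Args ss} → OccursArgs y as → OccursArgs y (φ ∷ as)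

  Distinct : ∀ {t u} → StSym t → StSym u → Set
  Distinct {t} {u} y z = ¬ (_≡_ {A = Σ Sort StSym} (t , y) (u , z))

  data ⊢ : (s : Sort) → Form s → Set where
    taut : ∀ {s} (P : PF) (f : ℕ → Form s) → Tautology P → ⊢ s (instPF f P)
    K-σ : ∀ {ss s t} (σ : Op ss s) (c : Ctx ss t) (φ χ : Form t) →
      ⊢ s (box σ (plug c (φ ⇒' χ)) ⇒' (box σ (plug c φ) ⇒' box σ (plug c χ)))
    Dual-σ : ∀ {ss s} (σ : Op ss s) (as : Args ss) →
      ⊢ s (app σ as ⇔' ¬' box σ (negArgs as))
    K-at : ∀ {s t} (z : StSym t) (φ ψ : Form t) →
      ⊢ s (at z (φ ⇒' ψ) ⇒' (at z φ ⇒' at z ψ))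
    SelfDual : ∀ {s t} (z : StSym t) (φ : Form t) →
      ⊢ s (at z φ ⇔' ¬' at z (¬' φ))
    Intro : ∀ {s} (z : StSym s) (φ : Form s) →
      ⊢ s (sym z ⇒' (φ ⇔' at z φ))
    Agree : ∀ {t t' u} (y : StSym t') (z : StSym u) (φ : Form u) →
      ⊢ t (at y (at {t'} z φ) ⇔' at z φ)
    Ref : ∀ {s t} (z : StSym t) → ⊢ s (at z (sym z))
    Back : ∀ {ss s t u} (σ : Op ss s) (c : Ctx ss t) (z : StSym u) (ψ : Form u) →
      ⊢ s (app σ (plug c (at z ψ)) ⇒' at z ψ)
    MP : ∀ {s} {φ ψ : Form s} → ⊢ s (φ ⇒' ψ) → ⊢ s φ → ⊢ s ψ
    UG : ∀ {ss s t} (σ : Op ss s) (c : Ctx ss t) {φ : Form t} →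
      ⊢ t φ → ⊢ s (box σ (plug c φ))
    BroadcastS : ∀ {s s' t} {z : StSym t} {φ : Form t} →
      ⊢ s (at z φ) → ⊢ s' (at z φ)
    Gen-at : ∀ {s s'} (z : StSym s') {φ : Form s'} → ⊢ s' φ → ⊢ s (at z φ)
    Paste0 : ∀ {s t} {z y : StSym t} {φ : Form t} {ψ : Form s} →
      Distinct y z → ¬ Occurs y φ → ¬ Occurs y ψ →
      ⊢ s (at z (sym y ∧' φ) ⇒' ψ) → ⊢ s (at z φ ⇒' ψ)
    Paste1 : ∀ {s ss t u} {z : StSym t} {σ : Op ss t} {c : Ctx ss u}
      {y : StSym u} {φ : Form u} {ψ : Form s} →
      Distinct y z → ¬ Occurs y φ → ¬ Occurs y ψ →
      ⊢ s (at z (app σ (plug c (sym y ∧' φ))) ⇒' ψ) →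
      ⊢ s (at z (app σ (plug c φ)) ⇒' ψ)

  conj : ∀ {t} → Form t → List (Form t) → Form t
  conj φ [] = φ
  conj φ (ψ ∷ ψs) = φ ∧' conj ψ ψs

  data AllIn {t} (Γ : Pred (Form t) 0ℓ) : List (Form t) → Set where
    []  : AllIn Γ []
    _∷_ : ∀ {φ φs} → φ ∈ Γ → AllIn Γ φs → AllIn Γ (φ ∷ φs)

  Consistent : ∀ t → Pred (Form t) 0ℓ → Set
  Consistent t Γ = (φ : Form t) (φs : List (Form t)) →
    φ ∈ Γ → AllIn Γ φs → ¬ ⊢ t (¬' conj φ φs)

  MaxConsistent : ∀ t → Pred (Form t) 0ℓ → Set
  MaxConsistent t Γ = Consistent t Γ × ((φ : Form t) → φ ∈ Γ ⊎ (¬' φ) ∈ Γ)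

  Δ : ∀ {s t} → Pred (Form s) 0ℓ → StSym t → Pred (Form t) 0ℓ
  Δ {s} Γ z φ = at {s} z φ ∈ Γ

-- Since @_z is a normal operator ((K@), (Gen@)), each Δ_z is closed under provable implication
-- and conjunction, so a derivation of ¬(φ₁ ∧ ⋯ ∧ φₙ) from Δ_z would put both @_z(φ₁ ∧ ⋯ ∧ φₙ)
-- and @_z¬(φ₁ ∧ ⋯ ∧ φₙ) into Γ, contradicting (SelfDual); (SelfDual) also turns @_z¬φ ∉ Γ into
-- @_zφ ∈ Γ, which gives maximality. (Agree) collapses the nested @ in part 2. (Intro) makes φ and
-- @_zφ equivalent in any maximal consistent set containing z: applied to Γ this is part 3, and
-- applied to Δ_y, together with part 2, it is part 4.
module Submission where

open import Defs
open import Level using (0ℓ)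
open import Data.Bool using (Bool; true; false; T; _∧_)
open import Data.Bool.Properties using (T-≡; T-∧)
open import Data.List using ([]; _∷_)
open import Data.Nat using (ℕ; zero; suc)
open import Data.Product using (Σ; _×_; _,_; proj₁; proj₂)
open import Data.Sum using (_⊎_; inj₁; inj₂)
open import Function using (_∘_)
open import Function.Bundles using (_⇔_; mk⇔; Equivalence)
open import Function.Construct.Composition using (_⇔-∘_)
open import Function.Construct.Symmetry using (⇔-sym)
open import Relation.Binary.PropositionalEquality using (_≡_; refl; trans)
open import Relation.Unary using (Pred; _∈_; _∉_; _≐_)

open Equivalence using (to; from)

infixr 5 _∷ᵛ_

_∷ᵛ_ : Bool → (ℕ → Bool) → ℕ → Bool
(b ∷ᵛ v) zero = b
(b ∷ᵛ v) (suc k) = v k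

restrict : ℕ → (ℕ → Bool) → ℕ → Bool
restrict zero v _ = false
restrict (suc n) v = v 0 ∷ᵛ restrict n (v ∘ suc)

allValuations : ℕ → ((ℕ → Bool) → Bool) → Bool
allValuations zero f = f (λ _ → false)
allValuations (suc n) f =
  allValuations n (f ∘ (true ∷ᵛ_)) ∧ allValuations n (f ∘ (false ∷ᵛ_))

allValuations-sound : ∀ n f → T (allValuations n f) → ∀ v → T (f (restrict n v))
allValuations-sound zero f check v = check
allValuations-sound (suc n) f check v with v 0 | to T-∧ check
... | true  | checkᵗ , _ = allValuations-sound n (f ∘ (true ∷ᵛ_)) checkᵗ (v ∘ suc)
... | false | _ , checkᶠ = allValuations-sound n (f ∘ (false ∷ᵛ_)) checkᶠ (v ∘ suc)

⇔⇒≐ : ∀ {A : Set} {P Q : Pred A 0ℓ} → (∀ {x} → x ∈ P ⇔ x ∈ Q) → P ≐ Q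
⇔⇒≐ P⇔Q = to P⇔Q , from P⇔Q

module _ (L : Language) where
  open Logic L

  infixr 5 _⇒ᵖ_
  infixr 6 _∧ᵖ_

  _⇒ᵖ_ _∧ᵖ_ _⇔ᵖ_ : PF → PF → PF
  P ⇒ᵖ Q = por (pneg P) Q
  P ∧ᵖ Q = pneg (por (pneg P) (pneg Q))
  P ⇔ᵖ Q = (P ⇒ᵖ Q) ∧ᵖ (Q ⇒ᵖ P)

  A B : PF
  A = pv 0
  B = pv 1

  -- varsBelow says that P mentions only variables below n; for a concrete P it is λ _ → refl.
  byTruthTable : ∀ n (P : PF) → (∀ v → evalPF v P ≡ evalPF (restrict n v) P) →
    T (allValuations n (λ v → evalPF v P)) → Tautology P
  byTruthTable n P varsBelow check v =
    trans (varsBelow v) (to T-≡ (allValuations-sound n (λ w → evalPF w P) check v))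

  [_,_] : ∀ {t} → Form t → Form t → ℕ → Form t
  [ φ , ψ ] zero = φ
  [ φ , ψ ] (suc _) = ψ

  tautology : ∀ {t} n (P : PF) (f : ℕ → Form t) →
    (∀ v → evalPF v P ≡ evalPF (restrict n v) P) → T (allValuations n (λ v → evalPF v P)) →
    ⊢ t (instPF f P)
  tautology n P f varsBelow check = taut P f (byTruthTable n P varsBelow check)

  ⊢-¬¬-intro : ∀ {t} {φ : Form t} → ⊢ t (φ ⇒' ¬' ¬' φ)
  ⊢-¬¬-intro {φ = φ} = tautology 1 (A ⇒ᵖ pneg (pneg A)) [ φ , φ ] (λ _ → refl) _

  ⊢-¬-∧-¬ : ∀ {t} {φ : Form t} → ⊢ t (¬' (φ ∧' ¬' φ))
  ⊢-¬-∧-¬ {φ = φ} = tautology 1 (pneg (A ∧ᵖ pneg A)) [ φ , φ ] (λ _ → refl) _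

  ⊢-¬-⇒-∧-¬ : ∀ {t} {φ ψ : Form t} → ⊢ t (¬' ((φ ⇒' ψ) ∧' φ ∧' ¬' ψ))
  ⊢-¬-⇒-∧-¬ {φ = φ} {ψ} =
    tautology 2 (pneg ((A ⇒ᵖ B) ∧ᵖ A ∧ᵖ pneg B)) [ φ , ψ ] (λ _ → refl) _

  ⊢-∧-intro : ∀ {t} {φ ψ : Form t} → ⊢ t (φ ⇒' ψ ⇒' φ ∧' ψ)
  ⊢-∧-intro {φ = φ} {ψ} = tautology 2 (A ⇒ᵖ B ⇒ᵖ A ∧ᵖ B) [ φ , ψ ] (λ _ → refl) _

  ⊢-⇔-elimˡ : ∀ {t} {φ ψ : Form t} → ⊢ t ((φ ⇔' ψ) ⇒' φ ⇒' ψ)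
  ⊢-⇔-elimˡ {φ = φ} {ψ} = tautology 2 ((A ⇔ᵖ B) ⇒ᵖ A ⇒ᵖ B) [ φ , ψ ] (λ _ → refl) _

  ⊢-⇔-elimʳ : ∀ {t} {φ ψ : Form t} → ⊢ t ((φ ⇔' ψ) ⇒' ψ ⇒' φ)
  ⊢-⇔-elimʳ {φ = φ} {ψ} = tautology 2 ((A ⇔ᵖ B) ⇒ᵖ B ⇒ᵖ A) [ φ , ψ ] (λ _ → refl) _

  module MaxConsistentSet {t} {Γ : Pred (Form t) 0ℓ} (mc : MaxConsistent t Γ) where

    consistent : Consistent t Γ
    consistent = proj₁ mc

    complete : (φ : Form t) → φ ∈ Γ ⊎ ¬' φ ∈ Γ
    complete = proj₂ mc

    ∈⇒¬∉ : ∀ {φ} → φ ∈ Γ → ¬' φ ∉ Γ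
    ∈⇒¬∉ {φ} φ∈Γ ¬φ∈Γ = consistent φ (¬' φ ∷ []) φ∈Γ (¬φ∈Γ ∷ []) ⊢-¬-∧-¬

    ⊢⇒∈ : ∀ {φ} → ⊢ t φ → φ ∈ Γ
    ⊢⇒∈ {φ} ⊢φ with complete φ
    ... | inj₁ φ∈Γ = φ∈Γ
    ... | inj₂ ¬φ∈Γ with () ← consistent (¬' φ) [] ¬φ∈Γ [] (MP ⊢-¬¬-intro ⊢φ)

    ⇒-∈ : ∀ {φ ψ} → (φ ⇒' ψ) ∈ Γ → φ ∈ Γ → ψ ∈ Γ
    ⇒-∈ {φ} {ψ} φ⇒ψ∈Γ φ∈Γ with complete ψ
    ... | inj₁ ψ∈Γ = ψ∈Γ
    ... | inj₂ ¬ψ∈Γ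
      with () ← consistent _ (φ ∷ ¬' ψ ∷ []) φ⇒ψ∈Γ (φ∈Γ ∷ ¬ψ∈Γ ∷ []) ⊢-¬-⇒-∧-¬

    ⊢⇒-∈ : ∀ {φ ψ} → ⊢ t (φ ⇒' ψ) → φ ∈ Γ → ψ ∈ Γ
    ⊢⇒-∈ ⊢φ⇒ψ = ⇒-∈ (⊢⇒∈ ⊢φ⇒ψ)

    ⇔-∈ : ∀ {φ ψ} → (φ ⇔' ψ) ∈ Γ → φ ∈ Γ ⇔ ψ ∈ Γ
    ⇔-∈ φ⇔ψ∈Γ = mk⇔ (⇒-∈ (⊢⇒-∈ ⊢-⇔-elimˡ φ⇔ψ∈Γ)) (⇒-∈ (⊢⇒-∈ ⊢-⇔-elimʳ φ⇔ψ∈Γ))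

    ⊢⇔-∈ : ∀ {φ ψ} → ⊢ t (φ ⇔' ψ) → φ ∈ Γ ⇔ ψ ∈ Γ
    ⊢⇔-∈ ⊢φ⇔ψ = ⇔-∈ (⊢⇒∈ ⊢φ⇔ψ)

  module DeltaSets {s} {Γ : Pred (Form s) 0ℓ} (mc : MaxConsistent s Γ) where
    open MaxConsistentSet mc

    Δ-mp : ∀ {t} {z : StSym t} {φ ψ} → (φ ⇒' ψ) ∈ Δ Γ z → φ ∈ Δ Γ z → ψ ∈ Δ Γ z
    Δ-mp {z = z} {φ} {ψ} = ⇒-∈ ∘ ⊢⇒-∈ (K-at z φ ψ)

    Δ-mono : ∀ {t} {z : StSym t} {φ ψ} → ⊢ t (φ ⇒' ψ) → φ ∈ Δ Γ z → ψ ∈ Δ Γ z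
    Δ-mono {z = z} ⊢φ⇒ψ = Δ-mp (⊢⇒∈ (Gen-at z ⊢φ⇒ψ))

    Δ-conj : ∀ {t} {z : StSym t} {φ φs} → φ ∈ Δ Γ z → AllIn (Δ Γ z) φs → conj φ φs ∈ Δ Γ z
    Δ-conj φ∈Δ [] = φ∈Δ
    Δ-conj φ∈Δ (ψ∈Δ ∷ ψs∈Δ) = Δ-mp (Δ-mono ⊢-∧-intro φ∈Δ) (Δ-conj ψ∈Δ ψs∈Δ)

    Δ-consistent : ∀ {t} (z : StSym t) → Consistent t (Δ Γ z)
    Δ-consistent z φ φs φ∈Δ φs∈Δ ⊢¬conj =
      ∈⇒¬∉ (⊢⇒∈ (Gen-at z ⊢¬conj)) (to (⊢⇔-∈ (SelfDual z (conj φ φs))) (Δ-conj φ∈Δ φs∈Δ))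

    Δ-complete : ∀ {t} (z : StSym t) (φ : Form t) → φ ∈ Δ Γ z ⊎ ¬' φ ∈ Δ Γ z
    Δ-complete z φ with complete (at z (¬' φ))
    ... | inj₁ ¬φ∈Δ = inj₂ ¬φ∈Δ
    ... | inj₂ ¬at¬φ∈Γ = inj₁ (from (⊢⇔-∈ (SelfDual z φ)) ¬at¬φ∈Γ)

    Δ-maxConsistent : ∀ {t} (z : StSym t) → MaxConsistent t (Δ Γ z)
    Δ-maxConsistent z = Δ-consistent z , Δ-complete z

    sym-∈-Δ : ∀ {t} (z : StSym t) → sym z ∈ Δ Γ z
    sym-∈-Δ z = ⊢⇒∈ (Ref z)

    at-∈-Δ : ∀ {t t'} (y : StSym t') (z : StSym t) (φ : Form t) → at z φ ∈ Δ Γ y ⇔ at {s} z φ ∈ Γ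
    at-∈-Δ y z φ = ⊢⇔-∈ (Agree y z φ)

    ≐-Δ : ∀ {z : StSym s} → sym z ∈ Γ → Γ ≐ Δ Γ z
    ≐-Δ {z} z∈Γ = ⇔⇒≐ λ {φ} → ⇔-∈ (⊢⇒-∈ (Intro z φ) z∈Γ)

    Δ-≐ : ∀ {t} {z y : StSym t} → sym z ∈ Δ Γ y → Δ {s} Γ z ≐ Δ Γ y
    Δ-≐ {z = z} {y} z∈Δy = ⇔⇒≐ λ {φ} →
      ⇔-sym (at-∈-Δ y z φ ⇔-∘ ⇔-∈-Δy (Δ-mono (Intro z φ) z∈Δy))
      where open MaxConsistentSet (Δ-maxConsistent y) using () renaming (⇔-∈ to ⇔-∈-Δy)

mainTheorem3 : (L : Language) → let open Logic L in
    (s : Language.Sort L) (Γ : Pred (Form s) 0ℓ) →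
    MaxConsistent s Γ → Σ (StSym s) (λ z₀ → sym z₀ ∈ Γ) →
    ((z : StSym s) → MaxConsistent s (Δ Γ z) × sym z ∈ Δ Γ z)
    × ((t : Language.Sort L) (z y : StSym t) (φ : Form t) → (at z φ ∈ Δ Γ y) ⇔ (at {s} z φ ∈ Γ))
    × Σ (StSym s) (λ z → Γ ≐ Δ Γ z)
    × ((t : Language.Sort L) (z y : StSym t) → sym z ∈ Δ Γ y → Δ {s} Γ z ≐ Δ Γ y)
mainTheorem3 L s Γ mc (z₀ , z₀∈Γ) =
    (λ z → Δ-maxConsistent z , sym-∈-Δ z)
  , (λ t z y φ → at-∈-Δ y z φ)
  , (z₀ , ≐-Δ z₀∈Γ)
  , (λ t z y → Δ-≐)
  where open DeltaSets L mc
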